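{- Let $\vec{P}(x,y)=(x,\ x+y,\ x+2y,\ x+y^2)$. For every integer $i\geqslant 2$: $\mathcal{P}_{i,j}=\mathbb{R}^4$ for $1\leqslant j\leqslant i$; $\mathcal{P}_{i,j}=\{0\}\times\{0\}\times\{0\}\times\mathbb{R}$ for $i+1\leqslant j\leqslant 2i$; and $\mathcal{P}_{i,j}=0$ for $j>2i$.
   Context: For a vector $\vec{v}=(v_1,\dots,v_t)$ and $l\in\mathbb{N}$, $\binom{\vec{v}}{l}=(\binom{v_1}{l},\dots,\binom{v_t}{l})$. Write $\binom{\vec{P}(x,y)}{l}=\sum_{a,b\geqslant 0}\vec{b}_{l,a,b}\binom{x}{a}\binom{y}{b}$ with $\vec{b}_{l,a,b}\in\mathbb{Z}^t$ (unique). For $i,j\in\mathbb{N}_+$, $\mathcal{P}_{i,j}$ is the real span of all $\vec{b}_{l,a,b}$ with $1\leqslant l\leqslant i$ and $a+b\geqslant j$.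
   Formalization: The spaces $\mathcal{P}_{i,j}$ are rational spans inside ℚ^4 rather than real spans inside ℝ^4, and the three target sets are taken as the corresponding subsets of ℚ^4. -}

module Defs where

open import Data.Nat using (ℕ; zero; suc; _+_; _≤_; _<_) renaming (_*_ to _*ₙ_)
open import Data.Nat.Combinatorics using (_C_)
open import Data.Integer as ℤ using (ℤ; +_)
open import Data.Rational as ℚ using (ℚ)
open import Data.Fin using (Fin)
open import Data.Vec using (Vec; []; _∷_; lookup)
open import Data.List using (List; []; _∷_)
open import Data.List.Relation.Unary.All using (All)
open import Data.Product using (_×_; _,_; Σ; ∃)
open import Relation.Binary.PropositionalEquality using (_≡_)

sumTo : ℕ → (ℕ → ℤ) → ℤ
sumTo zero    f = f 0
sumTo (suc n) f = sumTo n f ℤ.+ f (suc n)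

Pvec : ℕ → ℕ → Vec ℕ 4
Pvec x y = x ∷ (x + y) ∷ (x + 2 *ₙ y) ∷ (x + y *ₙ y) ∷ []

-- A family b l a c : ℤ^4 (as Fin 4 → ℤ) is the binomial-basis expansion of
-- binom(P(x,y), l):  binom(P(x,y),l) = Σ_{a,c ≥ 0} b l a c binom(x,a) binom(y,c).
-- At natural x,y the terms with a > x or c > y vanish, so the sum is finite.
-- Such a family exists and is unique (Newton interpolation), so this
-- characterises exactly the paper's coefficients b_{l,a,b}.
IsExpansion : (ℕ → ℕ → ℕ → Fin 4 → ℤ) → Set
IsExpansion b = ∀ (l x y : ℕ) (k : Fin 4) →
  + (lookup (Pvec x y) k C l)
    ≡ sumTo x (λ a → sumTo y (λ c → (+ ((x C a) *ₙ (y C c))) ℤ.* b l a c k))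

toℚ : ℤ → ℚ
toℚ z = z ℚ./ 1

sumℚ : List ℚ → ℚ
sumℚ []       = ℚ.0ℚ
sumℚ (q ∷ qs) = q ℚ.+ sumℚ qs

Allowed : ℕ → ℕ → ℕ × ℕ × ℕ → Set
Allowed i j (l , a , c) = (1 ≤ l × l ≤ i) × j ≤ a + c

combo : (ℕ → ℕ → ℕ → Fin 4 → ℤ) → List (ℚ × (ℕ × ℕ × ℕ)) → Fin 4 → ℚ
combo b []                          k = ℚ.0ℚ
combo b ((q , (l , a , c)) ∷ rest) k = q ℚ.* toℚ (b l a c k) ℚ.+ combo b rest k

InP : (ℕ → ℕ → ℕ → Fin 4 → ℤ) → ℕ → ℕ → (Fin 4 → ℚ) → Set
InP b i j v = Σ (List (ℚ × (ℕ × ℕ × ℕ))) λ L →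
  All (λ t → Allowed i j (Data.Product.proj₂ t)) L × (∀ k → v k ≡ combo b L k)

SameSet : ((Fin 4 → ℚ) → Set) → ((Fin 4 → ℚ) → Set) → Set
SameSet S T = ∀ v → (S v → T v) × (T v → S v)

module Submission where

-- Inverting the two Newton series of the expansion gives b_{l,a,c} = (Δ_y^c Δ_x^a binom(P, l))(0, 0).
-- Each component of P is x + q(y), and Pascal's rule Δ_x binom(x + q, l + 1) = binom(x + q, l)
-- turns this into b_{l,a,c} = (Δ^c binom(q(y), l - a))(0) for a ≤ l, and 0 for a > l.
-- Since (m + 1) binom(q, m + 1) = (q - m) binom(q, m) and multiplying by y raises the degree by one,
-- binom(q(y), m) has degree at most m for q = 0, y, 2y, and degree 2m for q = y² with 2m-th
-- difference (2m)!/m! ≠ 0. So the generators with a + c > l vanish in the first three components and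
-- those with a + c > 2l vanish entirely, whereas b_{i,i,0}, b_{i,i-1,1}, b_{i,i-2,2} and b_{i,0,2i},
-- namely (1,1,1,1), (0,1,2,1), (0,1,4,6) and (0,0,0,(2i)!/i!), span ℚ⁴.

open import Defs
open import Data.Nat as ℕ using (ℕ; zero; suc; z≤n; s≤s; _≤_; _<_; _+_; _*_; _^_; _!)
import Data.Nat.Properties as ℕₚ
import Data.Nat.Tactic.RingSolver as ℕ-Ring
open import Data.Nat.Combinatorics using (_C_; nCk+nC[k+1]≡[n+1]C[k+1]; nC1≡n; k>n⇒nCk≡0)
open import Data.Integer as ℤ using (ℤ; +_; 0ℤ)
import Data.Integer.Properties as ℤₚ
open import Data.Integer.GCD using (gcd)
open import Data.Integer.Tactic.RingSolver using (solve-∀)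
open import Data.Rational as ℚ using (ℚ; 0ℚ)
import Data.Rational.Properties as ℚₚ
open import Data.Rational.Solver using (module +-*-Solver)
open import Data.Fin using (Fin; zero; suc)
open import Data.Vec using (_∷_; []; lookup)
open import Data.List using (_∷_; [])
open import Data.List.Relation.Unary.All using (All; _∷_; [])
open import Data.Product using (_×_; _,_; proj₂)
open import Data.Unit using (⊤; tt)
open import Function using (_∘_; const)
open import Relation.Nullary using (yes; no)
open import Relation.Binary.PropositionalEquality
  using (_≡_; _≢_; _≗_; refl; sym; trans; cong; cong₂; subst; module ≡-Reasoning)
open ≡-Reasoning

Δ : (ℕ → ℤ) → ℕ → ℤ
Δ f y = f (suc y) ℤ.- f y

Δ^ : ℕ → (ℕ → ℤ) → ℕ → ℤ
Δ^ zero    f = f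
Δ^ (suc n) f = Δ^ n (Δ f)

Δ^-cong : ∀ n {f g : ℕ → ℤ} → f ≗ g → Δ^ n f ≗ Δ^ n g
Δ^-cong zero    f≗g = f≗g
Δ^-cong (suc n) f≗g = Δ^-cong n λ y → cong₂ ℤ._-_ (f≗g (suc y)) (f≗g y)

Δ^-suc : ∀ n f → Δ^ (suc n) f ≗ Δ (Δ^ n f)
Δ^-suc zero    f y = refl
Δ^-suc (suc n) f y = Δ^-suc n (Δ f) y

Δ^-+ : ∀ m n f → Δ^ (m + n) f ≗ Δ^ n (Δ^ m f)
Δ^-+ zero    n f y = refl
Δ^-+ (suc m) n f y = Δ^-+ m n (Δ f) y

Δ^-shift : ∀ n f → Δ^ n (f ∘ suc) ≗ Δ^ n f ∘ suc
Δ^-shift zero    f y = refl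
Δ^-shift (suc n) f y = Δ^-shift n (Δ f) y

Δ^-0 : ∀ n → Δ^ n (const 0ℤ) ≗ const 0ℤ
Δ^-0 zero    y = refl
Δ^-0 (suc n) y = Δ^-0 n y

Δ^-distrib-+ : ∀ n f g → Δ^ n (λ y → f y ℤ.+ g y) ≗ λ y → Δ^ n f y ℤ.+ Δ^ n g y
Δ^-distrib-+ zero    f g y = refl
Δ^-distrib-+ (suc n) f g y = trans
  (Δ^-cong n (λ y → interchange (f (suc y)) (g (suc y)) (f y) (g y)) y)
  (Δ^-distrib-+ n (Δ f) (Δ g) y)
  where
  interchange : ∀ a b c d → (a ℤ.+ b) ℤ.- (c ℤ.+ d) ≡ (a ℤ.- c) ℤ.+ (b ℤ.- d)
  interchange = solve-∀

Δ^-distrib-minus : ∀ n f g → Δ^ n (λ y → f y ℤ.- g y) ≗ λ y → Δ^ n f y ℤ.- Δ^ n g y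
Δ^-distrib-minus zero    f g y = refl
Δ^-distrib-minus (suc n) f g y = trans
  (Δ^-cong n (λ y → interchange (f (suc y)) (g (suc y)) (f y) (g y)) y)
  (Δ^-distrib-minus n (Δ f) (Δ g) y)
  where
  interchange : ∀ a b c d → (a ℤ.- b) ℤ.- (c ℤ.- d) ≡ (a ℤ.- c) ℤ.- (b ℤ.- d)
  interchange = solve-∀

Δ^-*ˡ : ∀ n z f → Δ^ n (λ y → z ℤ.* f y) ≗ λ y → z ℤ.* Δ^ n f y
Δ^-*ˡ zero    z f y = refl
Δ^-*ˡ (suc n) z f y = trans (Δ^-cong n (λ y → distrib z (f (suc y)) (f y)) y) (Δ^-*ˡ n z (Δ f) y)
  where
  distrib : ∀ z a c → z ℤ.* a ℤ.- z ℤ.* c ≡ z ℤ.* (a ℤ.- c)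
  distrib = solve-∀

Δ-*-id : ∀ f y → Δ (λ y → + y ℤ.* f y) y ≡ + y ℤ.* Δ f y ℤ.+ f (suc y)
Δ-*-id f y = leibniz (+ y) (f (suc y)) (f y)
  where
  leibniz : ∀ y a c → (+ 1 ℤ.+ y) ℤ.* a ℤ.- y ℤ.* c ≡ y ℤ.* (a ℤ.- c) ℤ.+ a
  leibniz = solve-∀

Δ^-suc-*-id : ∀ n f y →
  Δ^ (suc n) (λ y → + y ℤ.* f y) y ≡ + y ℤ.* Δ^ (suc n) f y ℤ.+ + suc n ℤ.* Δ^ n f (suc y)
Δ^-suc-*-id zero    f y =
  trans (Δ-*-id f y) (cong (ℤ._+_ (+ y ℤ.* Δ f y)) (sym (ℤₚ.*-identityˡ (f (suc y)))))
Δ^-suc-*-id (suc n) f y = begin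
  Δ^ (suc n) (Δ (λ y → + y ℤ.* f y)) y
    ≡⟨ Δ^-cong (suc n) (Δ-*-id f) y ⟩
  Δ^ (suc n) (λ y → + y ℤ.* Δ f y ℤ.+ f (suc y)) y
    ≡⟨ Δ^-distrib-+ (suc n) (λ y → + y ℤ.* Δ f y) (f ∘ suc) y ⟩
  Δ^ (suc n) (λ y → + y ℤ.* Δ f y) y ℤ.+ Δ^ (suc n) (f ∘ suc) y
    ≡⟨ cong₂ ℤ._+_ (Δ^-suc-*-id n (Δ f) y) (Δ^-shift (suc n) f y) ⟩
  (+ y ℤ.* Δ^ (suc (suc n)) f y ℤ.+ + suc n ℤ.* Δ^ (suc n) f (suc y)) ℤ.+ Δ^ (suc n) f (suc y)
    ≡⟨ collect (+ y) (Δ^ (suc (suc n)) f y) (+ n) (Δ^ (suc n) f (suc y)) ⟩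
  + y ℤ.* Δ^ (suc (suc n)) f y ℤ.+ + suc (suc n) ℤ.* Δ^ (suc n) f (suc y) ∎
  where
  collect : ∀ y a n b →
    (y ℤ.* a ℤ.+ (+ 1 ℤ.+ n) ℤ.* b) ℤ.+ b ≡ y ℤ.* a ℤ.+ (+ 1 ℤ.+ (+ 1 ℤ.+ n)) ℤ.* b
  collect = solve-∀

-- f is a polynomial of degree ≤ d whose d-th difference is L. It is a record rather than
-- Δ^ d f ≗ const L so that d and f can be inferred from it.
record ConstantΔ^ (d : ℕ) (f : ℕ → ℤ) (L : ℤ) : Set where
  constructor constantΔ^
  field Δ^≗L : Δ^ d f ≗ const L
open ConstantΔ^

ConstantΔ^-cong : ∀ {d f g L} → f ≗ g → ConstantΔ^ d f L → ConstantΔ^ d g L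
ConstantΔ^-cong {d} f≗g (constantΔ^ f≗L) = constantΔ^ λ y → trans (sym (Δ^-cong d f≗g y)) (f≗L y)

ConstantΔ^-suc : ∀ {d f L} → ConstantΔ^ d f L → ConstantΔ^ (suc d) f 0ℤ
ConstantΔ^-suc {d} {f} {L} (constantΔ^ f≗L) = constantΔ^ λ y → begin
  Δ^ (suc d) f y               ≡⟨ Δ^-suc d f y ⟩
  Δ^ d f (suc y) ℤ.- Δ^ d f y  ≡⟨ cong₂ ℤ._-_ (f≗L (suc y)) (f≗L y) ⟩
  L ℤ.- L                      ≡⟨ ℤₚ.+-inverseʳ L ⟩
  0ℤ                           ∎

ConstantΔ^-above : ∀ {d c f L} → ConstantΔ^ d f L → d < c → ConstantΔ^ c f 0ℤ
ConstantΔ^-above {d} {c} {f} f≗L d<c with o , refl ← ℕₚ.m≤n⇒∃[o]m+o≡n d<c = constantΔ^ λ y → trans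
  (Δ^-+ (suc d) o f y) (trans (Δ^-cong o (Δ^≗L (ConstantΔ^-suc f≗L)) y) (Δ^-0 o y))

ConstantΔ^-*ˡ : ∀ {d f L} z → ConstantΔ^ d f L → ConstantΔ^ d (λ y → z ℤ.* f y) (z ℤ.* L)
ConstantΔ^-*ˡ {d} {f} z (constantΔ^ f≗L) = constantΔ^ λ y →
  trans (Δ^-*ˡ d z f y) (cong (ℤ._*_ z) (f≗L y))

ConstantΔ^-*-id : ∀ {d f L} → ConstantΔ^ d f L →
  ConstantΔ^ (suc d) (λ y → + y ℤ.* f y) (+ suc d ℤ.* L)
ConstantΔ^-*-id {d} {f} {L} f≗L = constantΔ^ λ y → begin
  Δ^ (suc d) (λ y → + y ℤ.* f y) y
    ≡⟨ Δ^-suc-*-id d f y ⟩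
  + y ℤ.* Δ^ (suc d) f y ℤ.+ + suc d ℤ.* Δ^ d f (suc y)
    ≡⟨ cong₂ (λ a b → + y ℤ.* a ℤ.+ + suc d ℤ.* b) (Δ^≗L (ConstantΔ^-suc f≗L) y) (Δ^≗L f≗L (suc y)) ⟩
  + y ℤ.* 0ℤ ℤ.+ + suc d ℤ.* L
    ≡⟨ cong (ℤ._+ (+ suc d ℤ.* L)) (ℤₚ.*-zeroʳ (+ y)) ⟩
  0ℤ ℤ.+ + suc d ℤ.* L
    ≡⟨ ℤₚ.+-identityˡ (+ suc d ℤ.* L) ⟩
  + suc d ℤ.* L ∎

ConstantΔ^-minus-lower : ∀ {d f g L} → ConstantΔ^ d f L → ConstantΔ^ d g 0ℤ →
  ConstantΔ^ d (λ y → f y ℤ.- g y) L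
ConstantΔ^-minus-lower {d} {f} {g} {L} (constantΔ^ f≗L) (constantΔ^ g≗0) = constantΔ^ λ y → begin
  Δ^ d (λ y → f y ℤ.- g y) y  ≡⟨ Δ^-distrib-minus d f g y ⟩
  Δ^ d f y ℤ.- Δ^ d g y       ≡⟨ cong₂ ℤ._-_ (f≗L y) (g≗0 y) ⟩
  L ℤ.- 0ℤ                    ≡⟨ ℤₚ.+-identityʳ L ⟩
  L                           ∎

ConstantΔ^-cancelˡ : ∀ {d f L} n .{{_ : ℕ.NonZero n}} →
  ConstantΔ^ d (λ y → + n ℤ.* f y) (+ n ℤ.* L) → ConstantΔ^ d f L
ConstantΔ^-cancelˡ {d} {f} {L} n (constantΔ^ nf≗nL) = constantΔ^ λ y →
  ℤₚ.*-cancelˡ-≡ (+ n) (Δ^ d f y) L (trans (sym (Δ^-*ˡ d (+ n) f y)) (nf≗nL y))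

ConstantΔ^-factorial-above : ∀ {d c f L} m →
  ConstantΔ^ d (λ y → + (m !) ℤ.* f y) L → d < c → Δ^ c f 0 ≡ 0ℤ
ConstantΔ^-factorial-above m m!f≗L d<c = Δ^≗L (ConstantΔ^-cancelˡ (m !) {{m ℕₚ.!≢0}}
  (subst (ConstantΔ^ _ _) (sym (ℤₚ.*-zeroʳ (+ (m !)))) (ConstantΔ^-above m!f≗L d<c))) 0

pos-*-assoc : ∀ m n z → + (m * n) ℤ.* z ≡ + m ℤ.* (+ n ℤ.* z)
pos-*-assoc m n z = trans (cong (ℤ._* z) (ℤₚ.pos-* m n)) (ℤₚ.*-assoc (+ m) (+ n) z)

sumTo-cong : ∀ n {f g : ℕ → ℤ} → f ≗ g → sumTo n f ≡ sumTo n g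
sumTo-cong zero    f≗g = f≗g 0
sumTo-cong (suc n) f≗g = cong₂ ℤ._+_ (sumTo-cong n f≗g) (f≗g (suc n))

sumTo-distrib-+ : ∀ n f g → sumTo n (λ a → f a ℤ.+ g a) ≡ sumTo n f ℤ.+ sumTo n g
sumTo-distrib-+ zero    f g = refl
sumTo-distrib-+ (suc n) f g = trans
  (cong (ℤ._+ (f (suc n) ℤ.+ g (suc n))) (sumTo-distrib-+ n f g))
  (interchange (sumTo n f) (sumTo n g) (f (suc n)) (g (suc n)))
  where
  interchange : ∀ a b c d → (a ℤ.+ b) ℤ.+ (c ℤ.+ d) ≡ (a ℤ.+ c) ℤ.+ (b ℤ.+ d)
  interchange = solve-∀

sumTo-*ˡ : ∀ n z f → sumTo n (λ a → z ℤ.* f a) ≡ z ℤ.* sumTo n f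
sumTo-*ˡ zero    z f = refl
sumTo-*ˡ (suc n) z f = trans
  (cong (ℤ._+ (z ℤ.* f (suc n))) (sumTo-*ˡ n z f))
  (sym (ℤₚ.*-distribˡ-+ z (sumTo n f) (f (suc n))))

sumTo-suc : ∀ n f → sumTo (suc n) f ≡ f 0 ℤ.+ sumTo n (f ∘ suc)
sumTo-suc zero    f = refl
sumTo-suc (suc n) f = trans
  (cong (ℤ._+ f (suc (suc n))) (sumTo-suc n f))
  (ℤₚ.+-assoc (f 0) (sumTo n (f ∘ suc)) (f (suc (suc n))))

newton : (ℕ → ℤ) → ℕ → ℤ
newton u y = sumTo y (λ c → + (y C c) ℤ.* u c)

newton-suc : ∀ u y → newton u (suc y) ≡ newton u y ℤ.+ newton (u ∘ suc) y
newton-suc u y = begin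
  sumTo (suc y) (λ c → + (suc y C c) ℤ.* u c)
    ≡⟨ sumTo-suc y _ ⟩
  u₀ ℤ.+ sumTo y (λ c → + (suc y C suc c) ℤ.* u (suc c))
    ≡⟨ cong (ℤ._+_ u₀) (sumTo-cong y pascal) ⟩
  u₀ ℤ.+ sumTo y (λ c → + (y C c) ℤ.* u (suc c) ℤ.+ + (y C suc c) ℤ.* u (suc c))
    ≡⟨ cong (ℤ._+_ u₀) (sumTo-distrib-+ y _ _) ⟩
  u₀ ℤ.+ (newton (u ∘ suc) y ℤ.+ sumTo y (λ c → + (y C suc c) ℤ.* u (suc c)))
    ≡⟨ rotate u₀ (newton (u ∘ suc) y) _ ⟩
  (u₀ ℤ.+ sumTo y (λ c → + (y C suc c) ℤ.* u (suc c))) ℤ.+ newton (u ∘ suc) y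
    ≡⟨ cong (ℤ._+ newton (u ∘ suc) y) (sumTo-suc y (λ c → + (y C c) ℤ.* u c)) ⟨
  (newton u y ℤ.+ + (y C suc y) ℤ.* u (suc y)) ℤ.+ newton (u ∘ suc) y
    ≡⟨ cong (λ n → (newton u y ℤ.+ + n ℤ.* u (suc y)) ℤ.+ newton (u ∘ suc) y) (k>n⇒nCk≡0 (ℕₚ.n<1+n y)) ⟩
  (newton u y ℤ.+ 0ℤ) ℤ.+ newton (u ∘ suc) y
    ≡⟨ cong (ℤ._+ newton (u ∘ suc) y) (ℤₚ.+-identityʳ (newton u y)) ⟩
  newton u y ℤ.+ newton (u ∘ suc) y ∎
  where
  u₀ : ℤ
  u₀ = + 1 ℤ.* u 0
  pascal : ∀ c → + (suc y C suc c) ℤ.* u (suc c) ≡ + (y C c) ℤ.* u (suc c) ℤ.+ + (y C suc c) ℤ.* u (suc c)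
  pascal c = begin
    + (suc y C suc c) ℤ.* u (suc c)
      ≡⟨ cong (λ n → + n ℤ.* u (suc c)) (nCk+nC[k+1]≡[n+1]C[k+1] y c) ⟨
    + (y C c + y C suc c) ℤ.* u (suc c)
      ≡⟨ cong (ℤ._* u (suc c)) (ℤₚ.pos-+ (y C c) (y C suc c)) ⟩
    (+ (y C c) ℤ.+ + (y C suc c)) ℤ.* u (suc c)
      ≡⟨ ℤₚ.*-distribʳ-+ (u (suc c)) (+ (y C c)) (+ (y C suc c)) ⟩
    + (y C c) ℤ.* u (suc c) ℤ.+ + (y C suc c) ℤ.* u (suc c) ∎
  rotate : ∀ a b c → a ℤ.+ (b ℤ.+ c) ≡ (a ℤ.+ c) ℤ.+ b
  rotate = solve-∀

Δ-newton : ∀ u → Δ (newton u) ≗ newton (u ∘ suc)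
Δ-newton u y = trans (cong (ℤ._- newton u y) (newton-suc u y)) (cancel (newton u y) (newton (u ∘ suc) y))
  where
  cancel : ∀ a b → (a ℤ.+ b) ℤ.- a ≡ b
  cancel = solve-∀

newton-unique : ∀ {h} u → h ≗ newton u → ∀ c → u c ≡ Δ^ c h 0
newton-unique u h≗u zero    = sym (trans (h≗u 0) (ℤₚ.*-identityˡ (u 0)))
newton-unique u h≗u (suc c) =
  newton-unique (u ∘ suc) (λ y → trans (cong₂ ℤ._-_ (h≗u (suc y)) (h≗u y)) (Δ-newton u y)) c

newton-newton : ∀ (g : ℕ → ℕ → ℤ) x y →
  sumTo x (λ a → sumTo y (λ c → + ((x C a) * (y C c)) ℤ.* g a c)) ≡ newton (λ a → newton (g a) y) x
newton-newton g x y = sumTo-cong x λ a → begin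
  sumTo y (λ c → + ((x C a) * (y C c)) ℤ.* g a c)      ≡⟨ sumTo-cong y (λ c → pos-*-assoc (x C a) (y C c) (g a c)) ⟩
  sumTo y (λ c → + (x C a) ℤ.* (+ (y C c) ℤ.* g a c))  ≡⟨ sumTo-*ˡ y (+ (x C a)) _ ⟩
  + (x C a) ℤ.* newton (g a) y                          ∎

newton₂-unique : ∀ {F : ℕ → ℕ → ℤ} (g : ℕ → ℕ → ℤ) →
  (∀ x y → F x y ≡ sumTo x (λ a → sumTo y (λ c → + ((x C a) * (y C c)) ℤ.* g a c))) →
  ∀ a c → g a c ≡ Δ^ c (λ y → Δ^ a (λ x → F x y) 0) 0
newton₂-unique g F≡ a = newton-unique (g a) λ y →
  sym (newton-unique (λ a → newton (g a) y) (λ x → trans (F≡ x y) (newton-newton g x y)) a)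

[1+n]C[1+k]-nC[1+k]≡nCk : ∀ n k → + (suc n C suc k) ℤ.- + (n C suc k) ≡ + (n C k)
[1+n]C[1+k]-nC[1+k]≡nCk n k = begin
  + (suc n C suc k) ℤ.- + (n C suc k)
    ≡⟨ cong (λ m → + m ℤ.- + (n C suc k)) (nCk+nC[k+1]≡[n+1]C[k+1] n k) ⟨
  + (n C k + n C suc k) ℤ.- + (n C suc k)
    ≡⟨ cong (ℤ._- + (n C suc k)) (ℤₚ.pos-+ (n C k) (n C suc k)) ⟩
  (+ (n C k) ℤ.+ + (n C suc k)) ℤ.- + (n C suc k)
    ≡⟨ cancel (+ (n C k)) (+ (n C suc k)) ⟩
  + (n C k) ∎
  where
  cancel : ∀ a b → (a ℤ.+ b) ℤ.- b ≡ a
  cancel = solve-∀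

Δ^-binomial : ∀ q a m → Δ^ a (λ x → + ((x + q) C (a + m))) ≗ λ x → + ((x + q) C m)
Δ^-binomial q zero    m x = refl
Δ^-binomial q (suc a) m x =
  trans (Δ^-cong a (λ x → [1+n]C[1+k]-nC[1+k]≡nCk (x + q) (a + m)) x) (Δ^-binomial q a m x)

Δ^-binomial-vanishes : ∀ q {a l} → l < a → Δ^ a (λ x → + ((x + q) C l)) ≗ const 0ℤ
Δ^-binomial-vanishes q {a} {l} l<a = Δ^≗L (ConstantΔ^-above (constantΔ^ Δ^ˡ≗1) l<a)
  where
  Δ^ˡ≗1 : Δ^ l (λ x → + ((x + q) C l)) ≗ const (+ 1)
  Δ^ˡ≗1 x = trans
    (Δ^-cong l (λ x → cong (λ k → + ((x + q) C k)) (sym (ℕₚ.+-identityʳ l))) x)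
    (Δ^-binomial q l 0 x)

absorption : ∀ n m → + suc m ℤ.* + (n C suc m) ≡ (+ n ℤ.- + m) ℤ.* + (n C m)
absorption zero    zero    = refl
absorption zero    (suc m) = trans (ℤₚ.*-zeroʳ (+ suc (suc m))) (sym (ℤₚ.*-zeroʳ (+ 0 ℤ.- + suc m)))
absorption (suc n) zero    = begin
  + 1 ℤ.* + (suc n C 1)      ≡⟨ ℤₚ.*-identityˡ (+ (suc n C 1)) ⟩
  + (suc n C 1)              ≡⟨ cong +_ (nC1≡n (suc n)) ⟩
  + suc n                    ≡⟨ trans (ℤₚ.*-identityʳ _) (ℤₚ.+-identityʳ (+ suc n)) ⟨
  (+ suc n ℤ.- + 0) ℤ.* + 1  ∎
absorption (suc n) (suc m) = begin
  + suc (suc m) ℤ.* + (suc n C suc (suc m))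
    ≡⟨ cong (ℤ._*_ (+ suc (suc m))) (pascal (suc m)) ⟨
  + suc (suc m) ℤ.* (+ (n C suc m) ℤ.+ + (n C suc (suc m)))
    ≡⟨ ℤₚ.*-distribˡ-+ (+ suc (suc m)) (+ (n C suc m)) (+ (n C suc (suc m))) ⟩
  + suc (suc m) ℤ.* + (n C suc m) ℤ.+ + suc (suc m) ℤ.* + (n C suc (suc m))
    ≡⟨ cong (ℤ._+_ (+ suc (suc m) ℤ.* + (n C suc m))) (absorption n (suc m)) ⟩
  + suc (suc m) ℤ.* + (n C suc m) ℤ.+ (+ n ℤ.- + suc m) ℤ.* + (n C suc m)
    ≡⟨ regroup (+ m) (+ n) (+ (n C suc m)) ⟩
  + suc m ℤ.* + (n C suc m) ℤ.+ (+ n ℤ.- + m) ℤ.* + (n C suc m)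
    ≡⟨ cong (ℤ._+ (+ n ℤ.- + m) ℤ.* + (n C suc m)) (absorption n m) ⟩
  (+ n ℤ.- + m) ℤ.* + (n C m) ℤ.+ (+ n ℤ.- + m) ℤ.* + (n C suc m)
    ≡⟨ ℤₚ.*-distribˡ-+ (+ n ℤ.- + m) (+ (n C m)) (+ (n C suc m)) ⟨
  (+ n ℤ.- + m) ℤ.* (+ (n C m) ℤ.+ + (n C suc m))
    ≡⟨ cong₂ ℤ._*_ (shift (+ n) (+ m)) (pascal m) ⟩
  (+ suc n ℤ.- + suc m) ℤ.* + (suc n C suc m) ∎
  where
  pascal : ∀ k → + (n C k) ℤ.+ + (n C suc k) ≡ + (suc n C suc k)
  pascal k = trans (sym (ℤₚ.pos-+ (n C k) (n C suc k))) (cong +_ (nCk+nC[k+1]≡[n+1]C[k+1] n k))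
  regroup : ∀ m n b →
    (+ 1 ℤ.+ (+ 1 ℤ.+ m)) ℤ.* b ℤ.+ (n ℤ.- (+ 1 ℤ.+ m)) ℤ.* b ≡ (+ 1 ℤ.+ m) ℤ.* b ℤ.+ (n ℤ.- m) ℤ.* b
  regroup = solve-∀
  shift : ∀ n m → n ℤ.- m ≡ (+ 1 ℤ.+ n) ℤ.- (+ 1 ℤ.+ m)
  shift = solve-∀

-- Scaling by m! turns the absorption identity into a recursion without division.
factorial-binomial-suc : ∀ m n → let F = + (m !) ℤ.* + (n C m) in
  + (suc m !) ℤ.* + (n C suc m) ≡ + n ℤ.* F ℤ.- + m ℤ.* F
factorial-binomial-suc m n = begin
  + (suc m * m !) ℤ.* + (n C suc m)          ≡⟨ pos-*-assoc (suc m) (m !) (+ (n C suc m)) ⟩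
  + suc m ℤ.* (+ (m !) ℤ.* + (n C suc m))    ≡⟨ swap (+ suc m) (+ (m !)) (+ (n C suc m)) ⟩
  + (m !) ℤ.* (+ suc m ℤ.* + (n C suc m))    ≡⟨ cong (ℤ._*_ (+ (m !))) (absorption n m) ⟩
  + (m !) ℤ.* ((+ n ℤ.- + m) ℤ.* + (n C m))  ≡⟨ expand (+ (m !)) (+ n) (+ m) (+ (n C m)) ⟩
  + n ℤ.* (+ (m !) ℤ.* + (n C m)) ℤ.- + m ℤ.* (+ (m !) ℤ.* + (n C m)) ∎
  where
  swap : ∀ a b c → a ℤ.* (b ℤ.* c) ≡ b ℤ.* (a ℤ.* c)
  swap = solve-∀
  expand : ∀ f n m b → f ℤ.* ((n ℤ.- m) ℤ.* b) ≡ n ℤ.* (f ℤ.* b) ℤ.- m ℤ.* (f ℤ.* b)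
  expand = solve-∀

linear-binomial-degree : ∀ s m →
  ConstantΔ^ m (λ y → + (m !) ℤ.* + ((s * y) C m)) (+ (s ^ m * m !))
linear-binomial-degree s zero    = constantΔ^ λ _ → refl
linear-binomial-degree s (suc m) = subst (ConstantΔ^ (suc m) _) leading-term
  (ConstantΔ^-cong (sym ∘ step) (ConstantΔ^-minus-lower
    (ConstantΔ^-*ˡ (+ s) (ConstantΔ^-*-id F≗L))
    (ConstantΔ^-suc (ConstantΔ^-*ˡ (+ m) F≗L))))
  where
  F : ℕ → ℤ
  F y = + (m !) ℤ.* + ((s * y) C m)
  F≗L : ConstantΔ^ m F (+ (s ^ m * m !))
  F≗L = linear-binomial-degree s m
  step : ∀ y → + (suc m !) ℤ.* + ((s * y) C suc m) ≡ + s ℤ.* (+ y ℤ.* F y) ℤ.- + m ℤ.* F y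
  step y = trans (factorial-binomial-suc m (s * y)) (cong (ℤ._- + m ℤ.* F y) (pos-*-assoc s y (F y)))
  rearrange : ∀ s k a f → s * (k * (a * f)) ≡ s * a * (k * f)
  rearrange = ℕ-Ring.solve-∀
  leading-term : + s ℤ.* (+ suc m ℤ.* + (s ^ m * m !)) ≡ + (s ^ suc m * suc m !)
  leading-term = begin
    + s ℤ.* (+ suc m ℤ.* + (s ^ m * m !))  ≡⟨ cong (ℤ._*_ (+ s)) (ℤₚ.pos-* (suc m) (s ^ m * m !)) ⟨
    + s ℤ.* + (suc m * (s ^ m * m !))      ≡⟨ ℤₚ.pos-* s (suc m * (s ^ m * m !)) ⟨
    + (s * (suc m * (s ^ m * m !)))        ≡⟨ cong +_ (rearrange s (suc m) (s ^ m) (m !)) ⟩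
    + (s ^ suc m * suc m !)                ∎

square-binomial-degree : ∀ m →
  ConstantΔ^ (m + m) (λ y → + (m !) ℤ.* + ((y * y) C m)) (+ ((m + m) !))
square-binomial-degree zero    = constantΔ^ λ _ → refl
square-binomial-degree (suc m) = subst (λ d → ConstantΔ^ d G (+ (d !))) (cong suc (sym (ℕₚ.+-suc m m)))
  (subst (ConstantΔ^ (2 + k) G) leading-term
    (ConstantΔ^-cong (sym ∘ step) (ConstantΔ^-minus-lower
      (ConstantΔ^-*-id (ConstantΔ^-*-id F≗L))
      (ConstantΔ^-above (ConstantΔ^-*ˡ (+ m) F≗L) (ℕₚ.m<n⇒m<1+n (ℕₚ.n<1+n k))))))
  where
  k = m + m
  G F : ℕ → ℤ
  G y = + (suc m !) ℤ.* + ((y * y) C suc m)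
  F y = + (m !) ℤ.* + ((y * y) C m)
  F≗L : ConstantΔ^ k F (+ (k !))
  F≗L = square-binomial-degree m
  step : ∀ y → G y ≡ + y ℤ.* (+ y ℤ.* F y) ℤ.- + m ℤ.* F y
  step y = trans (factorial-binomial-suc m (y * y)) (cong (ℤ._- + m ℤ.* F y) (pos-*-assoc y y (F y)))
  leading-term : + (2 + k) ℤ.* (+ (1 + k) ℤ.* + (k !)) ≡ + ((2 + k) !)
  leading-term = begin
    + (2 + k) ℤ.* (+ (1 + k) ℤ.* + (k !))  ≡⟨ cong (ℤ._*_ (+ (2 + k))) (ℤₚ.pos-* (1 + k) (k !)) ⟨
    + (2 + k) ℤ.* + ((1 + k) !)            ≡⟨ ℤₚ.pos-* (2 + k) ((1 + k) !) ⟨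
    + ((2 + k) !)                          ∎

Pʸ : Fin 4 → ℕ → ℕ
Pʸ k y = lookup (Pvec 0 y) k

Pvec-split : ∀ x y k → lookup (Pvec x y) k ≡ x + Pʸ k y
Pvec-split x y zero                   = sym (ℕₚ.+-identityʳ x)
Pvec-split x y (suc zero)             = refl
Pvec-split x y (suc (suc zero))       = refl
Pvec-split x y (suc (suc (suc zero))) = refl

-- binom(P_k(x, y), l) has total degree degP k * l.
degP : Fin 4 → ℕ
degP = lookup (1 ∷ 1 ∷ 1 ∷ 2 ∷ [])

degP-nonZero : ∀ k → ℕ.NonZero (degP k)
degP-nonZero zero                   = _
degP-nonZero (suc zero)             = _
degP-nonZero (suc (suc zero))       = _
degP-nonZero (suc (suc (suc zero))) = _

degP≤2 : ∀ k → degP k ≤ 2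
degP≤2 zero                   = s≤s z≤n
degP≤2 (suc zero)             = s≤s z≤n
degP≤2 (suc (suc zero))       = s≤s z≤n
degP≤2 (suc (suc (suc zero))) = ℕₚ.≤-refl

Δ^-binomial-Pʸ-vanishes : ∀ k {m c} → degP k * m < c → Δ^ c (λ y → + (Pʸ k y C m)) 0 ≡ 0ℤ
Δ^-binomial-Pʸ-vanishes zero {m} m<c =
  Δ^≗L (ConstantΔ^-above {0} {f = const (+ (0 C m))} (constantΔ^ λ _ → refl) (ℕₚ.≤-<-trans z≤n m<c)) 0
Δ^-binomial-Pʸ-vanishes (suc zero) {m} {c} m<c = ConstantΔ^-factorial-above m
  (ConstantΔ^-cong (λ y → cong (λ n → + (m !) ℤ.* + (n C m)) (ℕₚ.*-identityˡ y)) (linear-binomial-degree 1 m))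
  (subst (_< c) (ℕₚ.*-identityˡ m) m<c)
Δ^-binomial-Pʸ-vanishes (suc (suc zero)) {m} {c} m<c = ConstantΔ^-factorial-above m
  (linear-binomial-degree 2 m) (subst (_< c) (ℕₚ.*-identityˡ m) m<c)
Δ^-binomial-Pʸ-vanishes (suc (suc (suc zero))) {m} {c} m<c = ConstantΔ^-factorial-above m
  (square-binomial-degree m) (subst (_< c) (cong (_+_ m) (ℕₚ.+-identityʳ m)) m<c)

-- ω i = (2i)! / i! is the last component of b_{i,0,2i}.
ω : ℕ → ℤ
ω i = Δ^ (i + i) (λ y → + ((y * y) C i)) 0

ω≢0 : ∀ i → ω i ≢ 0ℤ
ω≢0 i ω≡0 = ℕ.≢-nonZero⁻¹ ((i + i) !) {{(i + i) ℕₚ.!≢0}} (ℤₚ.+-injective (begin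
  + ((i + i) !)                                     ≡⟨ Δ^≗L (square-binomial-degree i) 0 ⟨
  Δ^ (i + i) (λ y → + (i !) ℤ.* + ((y * y) C i)) 0  ≡⟨ Δ^-*ˡ (i + i) (+ (i !)) _ 0 ⟩
  + (i !) ℤ.* ω i                                   ≡⟨ cong (ℤ._*_ (+ (i !))) ω≡0 ⟩
  + (i !) ℤ.* 0ℤ                                    ≡⟨ ℤₚ.*-zeroʳ (+ (i !)) ⟩
  0ℤ                                                ∎))

*-+-cancelˡ-< : ∀ e a m c .{{_ : ℕ.NonZero e}} → e * (a + m) < a + c → e * m < c
*-+-cancelˡ-< e a m c lt = ℕₚ.+-cancelˡ-< a (e * m) c (ℕₚ.≤-<-trans
  (ℕₚ.+-monoˡ-≤ (e * m) (ℕₚ.m≤n*m a e)) (subst (_< a + c) (ℕₚ.*-distribˡ-+ e a m) lt))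

1*i<0+[i+i] : ∀ i → 1 ≤ i → 1 * i < 0 + (i + i)
1*i<0+[i+i] i 1≤i = subst (_< i + i) (sym (ℕₚ.*-identityˡ i)) (ℕₚ.m<m+n i 1≤i)

toℚ-nonZero : ∀ {z} → z ≢ 0ℤ → ℚ.NonZero (toℚ z)
toℚ-nonZero {z} z≢0 = ℚ.≢-nonZero λ z/1≡0 → z≢0 (begin
  z                            ≡⟨ ℚₚ.↥-/ z 1 ⟨
  ℚ.↥ (toℚ z) ℤ.* gcd z (+ 1)  ≡⟨ cong (ℤ._* gcd z (+ 1)) (ℚₚ.p≡0⇒↥p≡0 (toℚ z) z/1≡0) ⟩
  0ℤ ℤ.* gcd z (+ 1)           ≡⟨ ℤₚ.*-zeroˡ (gcd z (+ 1)) ⟩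
  0ℤ                           ∎)

÷-*-cancel : ∀ x p .{{_ : ℚ.NonZero p}} → x ℚ.÷ p ℚ.* p ≡ x
÷-*-cancel x p = begin
  x ℚ.* ℚ.1/ p ℚ.* p    ≡⟨ ℚₚ.*-assoc x (ℚ.1/ p) p ⟩
  x ℚ.* (ℚ.1/ p ℚ.* p)  ≡⟨ cong (ℚ._*_ x) (ℚₚ.*-inverseˡ p) ⟩
  x ℚ.* ℚ.1ℚ            ≡⟨ ℚₚ.*-identityʳ x ⟩
  x                     ∎

module _ (b : ℕ → ℕ → ℕ → Fin 4 → ℤ) where

  generator : ℕ × ℕ × ℕ → Fin 4 → ℤ
  generator (l , a , c) = b l a c

  combo-vanishes : ∀ {P : ℕ × ℕ × ℕ → Set} {L} k →
    (∀ {t} → P t → generator t k ≡ 0ℤ) → All (P ∘ proj₂) L → combo b L k ≡ 0ℚ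
  combo-vanishes k t↦0 [] = refl
  combo-vanishes {L = (q , t) ∷ L} k t↦0 (p ∷ ps) = begin
    q ℚ.* toℚ (generator t k) ℚ.+ combo b L k
      ≡⟨ cong₂ (λ z r → q ℚ.* toℚ z ℚ.+ r) (t↦0 p) (combo-vanishes k t↦0 ps) ⟩
    q ℚ.* 0ℚ ℚ.+ 0ℚ  ≡⟨ ℚₚ.+-identityʳ (q ℚ.* 0ℚ) ⟩
    q ℚ.* 0ℚ         ≡⟨ ℚₚ.*-zeroʳ q ⟩
    0ℚ               ∎

  InP-component-vanishes : ∀ {i j v} k →
    (∀ {t} → Allowed i j t → generator t k ≡ 0ℤ) → InP b i j v → v k ≡ 0ℚ
  InP-component-vanishes k t↦0 (L , allowed , v≗L) = trans (v≗L k) (combo-vanishes k t↦0 allowed)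

  InP-spanned : ∀ {i j} t₀ t₁ t₂ t₃ {w} → w ≢ 0ℤ → All (Allowed i j) (t₀ ∷ t₁ ∷ t₂ ∷ t₃ ∷ []) →
    generator t₀ ≗ const (+ 1) →
    generator t₁ ≗ lookup (+ 0 ∷ + 1 ∷ + 2 ∷ + 1 ∷ []) →
    generator t₂ ≗ lookup (+ 0 ∷ + 1 ∷ + 4 ∷ + 6 ∷ []) →
    generator t₃ ≗ lookup (+ 0 ∷ + 0 ∷ + 0 ∷ w ∷ []) →
    ∀ v → InP b i j v
  InP-spanned t₀ t₁ t₂ t₃ {w} w≢0 (a₀ ∷ a₁ ∷ a₂ ∷ a₃ ∷ []) e₀ e₁ e₂ e₃ v =
    (α , t₀) ∷ (β , t₁) ∷ (γ , t₂) ∷ (δ , t₃) ∷ [] , a₀ ∷ a₁ ∷ a₂ ∷ a₃ ∷ [] , components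
    where
    open +-*-Solver
    instance
      w≢0ℚ : ℚ.NonZero (toℚ w)
      w≢0ℚ = toℚ-nonZero w≢0
    k₁ k₂ k₃ : Fin 4
    k₁ = suc zero
    k₂ = suc (suc zero)
    k₃ = suc (suc (suc zero))
    two four six α β γ δ : ℚ
    two = + 2 ℚ./ 1
    four = + 4 ℚ./ 1
    six = + 6 ℚ./ 1
    γ = (v k₂ ℚ.- two ℚ.* v k₁ ℚ.+ v zero) ℚ.* ℚ.½
    β = v k₁ ℚ.- v zero ℚ.- γ
    α = v zero
    δ = (v k₃ ℚ.- (α ℚ.+ β ℚ.+ γ ℚ.* six)) ℚ.÷ toℚ w
    components : ∀ k → v k ≡ combo b ((α , t₀) ∷ (β , t₁) ∷ (γ , t₂) ∷ (δ , t₃) ∷ []) k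
    components zero rewrite e₀ zero | e₁ zero | e₂ zero | e₃ zero = solve 4
      (λ a b g d → a := a :* con ℚ.1ℚ :+ (b :* con 0ℚ :+ (g :* con 0ℚ :+ (d :* con 0ℚ :+ con 0ℚ))))
      refl α β γ δ
    components (suc zero) rewrite e₀ k₁ | e₁ k₁ | e₂ k₁ | e₃ k₁ = solve 4
      (λ x₀ x₁ g d → x₁ := x₀ :* con ℚ.1ℚ
                             :+ ((x₁ :- x₀ :- g) :* con ℚ.1ℚ :+ (g :* con ℚ.1ℚ :+ (d :* con 0ℚ :+ con 0ℚ))))
      refl (v zero) (v k₁) γ δ
    components (suc (suc zero)) rewrite e₀ k₂ | e₁ k₂ | e₂ k₂ | e₃ k₂ = solve 4
      (λ x₀ x₁ x₂ d → let g = (x₂ :- con two :* x₁ :+ x₀) :* con ℚ.½ in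
         x₂ := x₀ :* con ℚ.1ℚ :+ ((x₁ :- x₀ :- g) :* con two :+ (g :* con four :+ (d :* con 0ℚ :+ con 0ℚ))))
      refl (v zero) (v k₁) (v k₂) δ
    components (suc (suc (suc zero))) rewrite e₀ k₃ | e₁ k₃ | e₂ k₃ | e₃ k₃ = sym (begin
      α ℚ.* ℚ.1ℚ ℚ.+ (β ℚ.* ℚ.1ℚ ℚ.+ (γ ℚ.* six ℚ.+ (δ ℚ.* toℚ w ℚ.+ 0ℚ)))
        ≡⟨ cong (λ t → α ℚ.* ℚ.1ℚ ℚ.+ (β ℚ.* ℚ.1ℚ ℚ.+ (γ ℚ.* six ℚ.+ (t ℚ.+ 0ℚ))))
                (÷-*-cancel (v k₃ ℚ.- (α ℚ.+ β ℚ.+ γ ℚ.* six)) (toℚ w)) ⟩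
      α ℚ.* ℚ.1ℚ ℚ.+ (β ℚ.* ℚ.1ℚ ℚ.+ (γ ℚ.* six ℚ.+ ((v k₃ ℚ.- (α ℚ.+ β ℚ.+ γ ℚ.* six)) ℚ.+ 0ℚ)))
        ≡⟨ solve 4 (λ a b g x₃ → a :* con ℚ.1ℚ :+ (b :* con ℚ.1ℚ :+ (g :* con six
                                   :+ ((x₃ :- (a :+ b :+ g :* con six)) :+ con 0ℚ))) := x₃)
             refl α β γ (v k₃) ⟩
      v k₃ ∎)

  InP-last-axis : ∀ {i j} t {w} → w ≢ 0ℤ → Allowed i j t →
    generator t ≗ lookup (+ 0 ∷ + 0 ∷ + 0 ∷ w ∷ []) →
    ∀ v → (v zero ≡ 0ℚ × v (suc zero) ≡ 0ℚ) × v (suc (suc zero)) ≡ 0ℚ → InP b i j v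
  InP-last-axis t {w} w≢0 allowed e v ((v₀≡0 , v₁≡0) , v₂≡0) = (δ , t) ∷ [] , allowed ∷ [] , components
    where
    instance
      w≢0ℚ : ℚ.NonZero (toℚ w)
      w≢0ℚ = toℚ-nonZero w≢0
    k₃ : Fin 4
    k₃ = suc (suc (suc zero))
    δ : ℚ
    δ = v k₃ ℚ.÷ toℚ w
    δ*0+0≡0 : δ ℚ.* 0ℚ ℚ.+ 0ℚ ≡ 0ℚ
    δ*0+0≡0 = trans (ℚₚ.+-identityʳ (δ ℚ.* 0ℚ)) (ℚₚ.*-zeroʳ δ)
    components : ∀ k → v k ≡ combo b ((δ , t) ∷ []) k
    components zero                   rewrite e zero             = trans v₀≡0 (sym δ*0+0≡0)
    components (suc zero)             rewrite e (suc zero)       = trans v₁≡0 (sym δ*0+0≡0)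
    components (suc (suc zero))       rewrite e (suc (suc zero)) = trans v₂≡0 (sym δ*0+0≡0)
    components (suc (suc (suc zero))) rewrite e k₃ =
      sym (trans (ℚₚ.+-identityʳ (δ ℚ.* toℚ w)) (÷-*-cancel (v k₃) (toℚ w)))

module _ {b : ℕ → ℕ → ℕ → Fin 4 → ℤ} (expansion : IsExpansion b) where

  coefficient-formula : ∀ l a c k → b l a c k ≡ Δ^ c (λ y → Δ^ a (λ x → + ((x + Pʸ k y) C l)) 0) 0
  coefficient-formula l a c k = trans
    (newton₂-unique (λ a c → b l a c k) (λ x y → expansion l x y k) a c)
    (Δ^-cong c (λ y → Δ^-cong a (λ x → cong (λ n → + (n C l)) (Pvec-split x y k)) 0) 0)

  coefficient : ∀ {l a m} c k → a + m ≡ l → b l a c k ≡ Δ^ c (λ y → + (Pʸ k y C m)) 0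
  coefficient {a = a} {m} c k refl =
    trans (coefficient-formula (a + m) a c k) (Δ^-cong c (λ y → Δ^-binomial (Pʸ k y) a m 0) 0)

  coefficient-vanishes : ∀ {l a c} k → degP k * l < a + c → b l a c k ≡ 0ℤ
  coefficient-vanishes {l} {a} {c} k lt with a ℕ.≤? l
  ... | yes a≤l with m , refl ← ℕₚ.m≤n⇒∃[o]m+o≡n a≤l =
    trans (coefficient c k refl) (Δ^-binomial-Pʸ-vanishes k (*-+-cancelˡ-< (degP k) a m c {{degP-nonZero k}} lt))
  ... | no a≰l = begin
    b l a c k
      ≡⟨ coefficient-formula l a c k ⟩
    Δ^ c (λ y → Δ^ a (λ x → + ((x + Pʸ k y) C l)) 0) 0
      ≡⟨ Δ^-cong c (λ y → Δ^-binomial-vanishes (Pʸ k y) (ℕₚ.≰⇒> a≰l) 0) 0 ⟩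
    Δ^ c (const 0ℤ) 0
      ≡⟨ Δ^-0 c 0 ⟩
    0ℤ ∎

  coefficient-i-i-0 : ∀ i k → b i i 0 k ≡ + 1
  coefficient-i-i-0 i k = coefficient 0 k (ℕₚ.+-identityʳ i)

  coefficient-i-[i-1]-1 : ∀ n k → b (2 + n) (1 + n) 1 k ≡ lookup (+ 0 ∷ + 1 ∷ + 2 ∷ + 1 ∷ []) k
  coefficient-i-[i-1]-1 n k = trans (coefficient 1 k (ℕₚ.+-comm (1 + n) 1)) (Δ¹ k)
    where
    Δ¹ : ∀ k → Δ^ 1 (λ y → + (Pʸ k y C 1)) 0 ≡ lookup (+ 0 ∷ + 1 ∷ + 2 ∷ + 1 ∷ []) k
    Δ¹ zero                   = refl
    Δ¹ (suc zero)             = refl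
    Δ¹ (suc (suc zero))       = refl
    Δ¹ (suc (suc (suc zero))) = refl

  coefficient-i-[i-2]-2 : ∀ n k → b (2 + n) n 2 k ≡ lookup (+ 0 ∷ + 1 ∷ + 4 ∷ + 6 ∷ []) k
  coefficient-i-[i-2]-2 n k = trans (coefficient 2 k (ℕₚ.+-comm n 2)) (Δ² k)
    where
    Δ² : ∀ k → Δ^ 2 (λ y → + (Pʸ k y C 2)) 0 ≡ lookup (+ 0 ∷ + 1 ∷ + 4 ∷ + 6 ∷ []) k
    Δ² zero                   = refl
    Δ² (suc zero)             = refl
    Δ² (suc (suc zero))       = refl
    Δ² (suc (suc (suc zero))) = refl

  coefficient-i-0-2i : ∀ i → 1 ≤ i → ∀ k → b i 0 (i + i) k ≡ lookup (+ 0 ∷ + 0 ∷ + 0 ∷ ω i ∷ []) k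
  coefficient-i-0-2i i 1≤i zero                   = coefficient-vanishes zero (1*i<0+[i+i] i 1≤i)
  coefficient-i-0-2i i 1≤i (suc zero)             = coefficient-vanishes (suc zero) (1*i<0+[i+i] i 1≤i)
  coefficient-i-0-2i i 1≤i (suc (suc zero))       = coefficient-vanishes (suc (suc zero)) (1*i<0+[i+i] i 1≤i)
  coefficient-i-0-2i i 1≤i (suc (suc (suc zero))) = coefficient (i + i) (suc (suc (suc zero))) refl

  allowed-vanishes : ∀ {i j} k → degP k * i < j → ∀ {t} → Allowed i j t → generator b t k ≡ 0ℤ
  allowed-vanishes k dk*i<j {l , a , c} ((_ , l≤i) , j≤a+c) =
    coefficient-vanishes k (ℕₚ.≤-<-trans (ℕₚ.*-monoʳ-≤ (degP k) l≤i) (ℕₚ.<-≤-trans dk*i<j j≤a+c))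

  InP-full : ∀ n {j} → j ≤ 2 + n → ∀ v → InP b (2 + n) j v
  InP-full n {j} j≤i = InP-spanned b (i , i , 0) (i , 1 + n , 1) (i , n , 2) (i , 0 , i + i) (ω≢0 i)
    ( allowed i 0 (ℕₚ.+-identityʳ i) ∷ allowed (1 + n) 1 (ℕₚ.+-comm (1 + n) 1) ∷ allowed n 2 (ℕₚ.+-comm n 2)
    ∷ ((s≤s z≤n , ℕₚ.≤-refl) , ℕₚ.≤-trans j≤i (ℕₚ.m≤m+n i i)) ∷ [])
    (coefficient-i-i-0 i) (coefficient-i-[i-1]-1 n) (coefficient-i-[i-2]-2 n) (coefficient-i-0-2i i (s≤s z≤n))
    where
    i = 2 + n
    allowed : ∀ a c → a + c ≡ i → Allowed i j (i , a , c)
    allowed a c a+c≡i = (s≤s z≤n , ℕₚ.≤-refl) , subst (j ≤_) (sym a+c≡i) j≤i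

  InP-middle : ∀ {i j} → 1 ≤ i → i < j → j ≤ 2 * i →
    SameSet (InP b i j) (λ v → (v zero ≡ 0ℚ × v (suc zero) ≡ 0ℚ) × v (suc (suc zero)) ≡ 0ℚ)
  InP-middle {i} {j} 1≤i i<j j≤2i v =
      (λ v∈P → (vanishes zero 1*i<j v∈P , vanishes (suc zero) 1*i<j v∈P) , vanishes (suc (suc zero)) 1*i<j v∈P)
    , InP-last-axis b (i , 0 , i + i) (ω≢0 i) ((1≤i , ℕₚ.≤-refl) , j≤i+i) (coefficient-i-0-2i i 1≤i) v
    where
    j≤i+i : j ≤ 0 + (i + i)
    j≤i+i = subst (j ≤_) (cong (_+_ i) (ℕₚ.+-identityʳ i)) j≤2i
    1*i<j : 1 * i < j
    1*i<j = subst (_< j) (sym (ℕₚ.*-identityˡ i)) i<j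
    vanishes : ∀ k → degP k * i < j → InP b i j v → v k ≡ 0ℚ
    vanishes k dk*i<j = InP-component-vanishes b k (allowed-vanishes k dk*i<j)

  InP-top : ∀ {i j} → 2 * i < j → SameSet (InP b i j) (λ v → (k : Fin 4) → v k ≡ 0ℚ)
  InP-top {i} {j} 2i<j v = (λ v∈P k → InP-component-vanishes b k (allowed-vanishes k (dk*i<j k)) v∈P)
                         , λ v≡0 → [] , [] , v≡0
    where
    dk*i<j : ∀ k → degP k * i < j
    dk*i<j k = ℕₚ.≤-<-trans (ℕₚ.*-monoˡ-≤ i (degP≤2 k)) 2i<j

lemma11p1 : (b : ℕ → ℕ → ℕ → Fin 4 → ℤ) → IsExpansion b →
    (i : ℕ) → 2 ≤ i →
      ((j : ℕ) → 1 ≤ j → j ≤ i → SameSet (InP b i j) (λ v → ⊤))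
      × ((j : ℕ) → i + 1 ≤ j → j ≤ 2 * i →
           SameSet (InP b i j) (λ v → (v zero ≡ 0ℚ × v (suc zero) ≡ 0ℚ) × v (suc (suc zero)) ≡ 0ℚ))
      × ((j : ℕ) → 2 * i < j → SameSet (InP b i j) (λ v → (k : Fin 4) → v k ≡ 0ℚ))
lemma11p1 b expansion i@(suc (suc n)) (s≤s (s≤s z≤n)) =
    (λ j _ j≤i v → (λ _ → tt) , λ _ → InP-full expansion n j≤i v)
  , (λ j i+1≤j j≤2i → InP-middle expansion (s≤s z≤n) (subst (_≤ j) (ℕₚ.+-comm i 1) i+1≤j) j≤2i)
  , (λ j 2i<j → InP-top expansion 2i<j)
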